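{- Let $m\ge2$, $n\ge1$, and let $w=\beta\prod_{k=1}^n t_k^{r_k}\in G(m,1,n)$, i.e. $w(k)=\varepsilon^{r_k}\beta_k$ for $1\le k\le n$, with $\beta=(\beta_1,\dots,\beta_n)\in S_n$ and $0\le r_k\le m-1$. Then for all $i=1,\dots,n$, \[ inv_i(w)=r_{n+1-i}+m\cdot\bigl|\{(j,n+1-i): j<n+1-i,\ \beta_j<\beta_{n+1-i},\ r_{n+1-i}\ne 0\}\bigr|+inv_i(\beta), \] where $inv_i(\beta)=|\{(j,n+1-i): j<n+1-i,\ \beta_j>\beta_{n+1-i}\}|$. In particular $inv_i(w)=inv_i(\beta)$ when $r_{n+1-i}=0$.
   Context: Let $\varepsilon=e^{2\pi i/m}$ and $e_1,\dots,e_n$ the standard basis of $\mathbb C^n$. $G(m,1,n)$ consists of the bijections $w$ of $\{\varepsilon^k i\}$ with $w(\varepsilon^k i)=\varepsilon^k w(i)$; $t_k$ is the element sending $k\mapsto\varepsilon k$ and fixing all other $j$, and products are composed right to left. The element $w$ with $w(j)=\varepsilon^{r_j}\beta_j$ acts linearly on $\mathbb C^n$ by $w(e_j)=\varepsilon^{r_j}e_{\beta_j}$. Let $\Phi=\{\varepsilon^i e_j-\varepsilon^k e_l : \varepsilon^i e_j\ne\varepsilon^k e_l,\ 0\le i,k\le m-1,\ 1\le j,l\le n\}$, $\Phi^+=\{\varepsilon^i e_j-\varepsilon^k e_j\in\Phi : 0\le i<k\le m-1\}\cup\{e_j-\varepsilon^k e_l\in\Phi: 0\le k\le m-1,\ 1\le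 l<j\le n\}\cup\{\varepsilon^i e_j-\varepsilon^k e_l\in\Phi: 0\le i,k\le m-1,\ k\ne 0,\ 1\le j<l\le n\}$, $\Phi^-=\Phi\setminus\Phi^+$, and for $i=1,\dots,n$, $\Delta_i=\{e_{n+1-i}-\varepsilon^k e_{n+1-i}: 0<k\le m-1\}\cup\{e_{n+1-i}-\varepsilon^k e_j: 0\le k\le m-1,\ j<n+1-i\}$. Define $inv_i(w)=|w(\Delta_i)\cap\Phi^-|$. -}

module Defs where

open import Data.Nat as ℕ using (ℕ; NonZero; >-nonZero⁻¹)
open import Data.Nat.DivMod using (_%_; m%n<n)
open import Data.Fin as F using (Fin; toℕ; fromℕ<; opposite; _<_; _<?_; _≟_)
open import Data.Fin.Permutation using (Permutation′; _⟨$⟩ʳ_)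
open import Data.Product using (_×_; _,_; proj₁; proj₂)
open import Data.Product.Properties using (≡-dec)
open import Data.Sum using (_⊎_)
open import Data.List using (List; []; _∷_; _++_; map; filter; length; concatMap)
open import Data.List.Base using (allFin)
open import Relation.Binary.PropositionalEquality using (_≡_; _≢_)
open import Relation.Nullary using (¬_; Dec; ¬?)
open import Relation.Nullary.Decidable using (_×-dec_; _⊎-dec_)
open import Relation.Unary using (Decidable)

𝟎 : (m : ℕ) .{{_ : NonZero m}} → Fin m
𝟎 m = fromℕ< (>-nonZero⁻¹ m)

_⊕_ : {m : ℕ} .{{_ : NonZero m}} → Fin m → Fin m → Fin m
_⊕_ {m} a b = fromℕ< (m%n<n (toℕ a ℕ.+ toℕ b) m)

-- ε^a e_j is represented by (a , j) : Fin m × Fin n   (0-based j).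
Vtx : ℕ → ℕ → Set
Vtx m n = Fin m × Fin n

-- A (formal) root ε^i e_j - ε^k e_l is represented by the pair ((i , j) , (k , l)).
Root : ℕ → ℕ → Set
Root m n = Vtx m n × Vtx m n

InΦ : {m n : ℕ} → Root m n → Set
InΦ (x , y) = x ≢ y

Pos : {m n : ℕ} → Root m n → Set
Pos ((i , j) , (k , l)) =
  (j ≡ l × i < k) ⊎ ((l < j × toℕ i ≡ 0) ⊎ (j < l × ¬ (toℕ k ≡ 0)))

Neg : {m n : ℕ} → Root m n → Set
Neg ρ = InΦ ρ × ¬ Pos ρ

Neg? : {m n : ℕ} → Decidable (Neg {m} {n})
Neg? ((i , j) , (k , l)) =
  ¬? (≡-dec _≟_ _≟_ (i , j) (k , l))
  ×-dec ¬? ((j ≟ l ×-dec i <? k)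
            ⊎-dec ((l <? j ×-dec toℕ i ℕ.≟ 0)
                   ⊎-dec (j <? l ×-dec ¬? (toℕ k ℕ.≟ 0))))

-- An element w = β ∏ t_k^{r_k} of G(m,1,n): w(k) = ε^{r_k} β_k.
record GElt (m n : ℕ) : Set where
  constructor ⟨_,_⟩
  field
    β : Permutation′ n
    r : Fin n → Fin m
open GElt public

actV : {m n : ℕ} .{{_ : NonZero m}} → GElt m n → Vtx m n → Vtx m n
actV w (a , j) = (a ⊕ r w j , β w ⟨$⟩ʳ j)

actRoot : {m n : ℕ} .{{_ : NonZero m}} → GElt m n → Root m n → Root m n
actRoot w (x , y) = (actV w x , actV w y)

-- Δ for the column p (0-based), i.e. p = n+1-i in 1-based numbering:
-- { e_p - ε^k e_p : 0 < k ≤ m-1 } ∪ { e_p - ε^k e_j : 0 ≤ k ≤ m-1, j < p }.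
Δcol : (m n : ℕ) .{{_ : NonZero m}} → Fin n → List (Root m n)
Δcol m n p =
  map (λ k → ((𝟎 m , p) , (k , p)))
      (filter (λ k → ¬? (toℕ k ℕ.≟ 0)) (allFin m))
  ++ concatMap (λ j → map (λ k → ((𝟎 m , p) , (k , j))) (allFin m))
               (filter (λ j → j <? p) (allFin n))

-- Δ_i for i (0-based index i0 = i-1); n+1-i corresponds to the 0-based index opposite i0.
Δ : (m n : ℕ) .{{_ : NonZero m}} → Fin n → List (Root m n)
Δ m n i = Δcol m n (opposite i)

-- inv_i(w) = |w(Δ_i) ∩ Φ⁻|   (w is injective, so the list w(Δ_i) has no repetitions).
inv : {m n : ℕ} .{{_ : NonZero m}} → Fin n → GElt m n → ℕ
inv {m} {n} i w = length (filter Neg? (map (actRoot w) (Δ m n i)))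

invPerm : {n : ℕ} → Fin n → Permutation′ n → ℕ
invPerm {n} i β =
  length (filter (λ j → (j <? opposite i) ×-dec ((β ⟨$⟩ʳ opposite i) <? (β ⟨$⟩ʳ j))) (allFin n))

ascCount : {m n : ℕ} → Fin n → GElt m n → ℕ
ascCount {m} {n} i w =
  length (filter (λ j → (j <? opposite i)
                        ×-dec (((β w ⟨$⟩ʳ j) <? (β w ⟨$⟩ʳ opposite i))
                        ×-dec ¬? (toℕ (r w (opposite i)) ℕ.≟ 0)))
                 (allFin n))

{-# OPTIONS --safe #-}
module Submission where

-- With p = n+1-i, the roots of Δ_i are e_p - ε^k e_j for j ≤ p, and w sends such a root to
-- ε^{r_p} e_{β_p} - ε^{k+r_j} e_{β_j}.  For j = p (and k ≠ 0) the image is negative exactly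
-- when k + r_p wraps around modulo m, which happens for r_p values of k.  For j < p with
-- β_j < β_p the sign does not depend on k: all m images are negative iff r_p ≠ 0.  For j < p
-- with β_j > β_p the image is negative iff ε^{k+r_j} = 1, i.e. for exactly one k.

open import Defs
open import Data.Bool.Base using (true; false; if_then_else_)
open import Data.Nat as ℕ using (ℕ; NonZero; zero; suc; _+_; _*_; _∸_; _≤_; z≤n; s≤s; s≤s⁻¹)
open import Data.Nat.Properties
  using ( _≤?_; 0∸n≡0; +-identityʳ; *-zeroʳ; *-comm; +-comm; +-assoc; ≤-trans; ≤-antisym; <⇒≤
        ; <-≤-trans; ≮⇒≥; <⇒≱; m≤n+m; +-mono-<; +-monoˡ-<; +-monoʳ-≤; ∸-monoˡ-<; m∸n≤m
        ; m∸n+n≡m; m+n∸n≡m; m+n∸m≡n; m∸[m∸n]≡n; m∸n≡0⇒m≤n; m<n+o⇒m∸n<o; m≤n+o⇒m∸n≤o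
        ; m≤n+m∸n; m<n⇒n≢0; m<n⇒0<n∸m; module ≤-Reasoning)
open import Data.Nat.Tactic.RingSolver using (solve-∀)
open import Data.Nat.DivMod using (_%_; m%n<n; m<n⇒m%n≡m; [m+n]%n≡m%n; n%n≡0)
open import Data.Nat.ListAction using (sum)
open import Data.Fin.Base as F using (Fin; zero; suc; toℕ; fromℕ<; opposite)
open import Data.Fin.Properties as F using (_≟_; _<?_; suc-injective; toℕ-injective; toℕ-fromℕ<; toℕ<n)
open import Data.Fin.Permutation using (_⟨$⟩ʳ_)
open import Data.List.Base
  using (List; []; _∷_; _++_; map; filter; length; concatMap; allFin; tabulate)
open import Data.List.Properties
  using (filter-++; length-++; filter-≐; map-tabulate; length-tabulate; map-cong-local)
import Data.List.Relation.Unary.All as All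
open import Data.List.Relation.Unary.All.Properties using (all-filter)
open import Data.Product.Base using (_×_; _,_; proj₁; proj₂)
open import Data.Sum.Base using (inj₁; inj₂)
open import Function.Base using (id; _∘′_)
open import Function.Bundles using (_⇔_; mk⇔; module Equivalence; module Injection)
open import Function.Construct.Composition using (_⇔-∘_)
open import Function.Properties.Inverse using (↔⇒↣)
open import Relation.Nullary using (Dec; does; yes; no; ¬_; ¬?; _×-dec_; contradiction)
open import Relation.Nullary.Decidable using (dec-true; dec-false; decidable-stable)
open import Relation.Unary using (Pred; Decidable)
open import Relation.Binary.Definitions using (tri<; tri≈; tri>)
open import Relation.Binary.PropositionalEquality
  using (_≡_; _≢_; refl; sym; trans; cong; cong₂; subst; module ≡-Reasoning)

𝟙 : ∀ {p} {P : Set p} → Dec P → ℕ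
𝟙 P? = if does P? then 1 else 0

𝟙-yes : ∀ {p} {P : Set p} (P? : Dec P) → P → 𝟙 P? ≡ 1
𝟙-yes P? Px = cong (if_then 1 else 0) (dec-true P? Px)

𝟙-no : ∀ {p} {P : Set p} (P? : Dec P) → ¬ P → 𝟙 P? ≡ 0
𝟙-no P? ¬Px = cong (if_then 1 else 0) (dec-false P? ¬Px)

𝟙-cong : ∀ {p q} {P : Set p} {Q : Set q} (P? : Dec P) (Q? : Dec Q) → P ⇔ Q → 𝟙 P? ≡ 𝟙 Q?
𝟙-cong P? Q? P⇔Q with Q?
... | yes Q = 𝟙-yes P? (Equivalence.from P⇔Q Q)
... | no ¬Q = 𝟙-no P? (λ P → ¬Q (Equivalence.to P⇔Q P))

count : ∀ {a p} {A : Set a} {P : Pred A p} → Decidable P → List A → ℕ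
count P? xs = length (filter P? xs)

module _ {a p} {A : Set a} {P : Pred A p} (P? : Decidable P) where

  count-∷ : ∀ x xs → count P? (x ∷ xs) ≡ 𝟙 (P? x) + count P? xs
  count-∷ x xs with does (P? x)
  ... | true  = refl
  ... | false = refl

  count-++ : ∀ xs ys → count P? (xs ++ ys) ≡ count P? xs + count P? ys
  count-++ xs ys = trans (cong length (filter-++ P? xs ys)) (length-++ (filter P? xs))

  count-all : (∀ x → P x) → ∀ xs → count P? xs ≡ length xs
  count-all P-all []       = refl
  count-all P-all (x ∷ xs) with P? x
  ... | yes _  = cong suc (count-all P-all xs)
  ... | no ¬Px = contradiction (P-all x) ¬Px

  count-none : (∀ x → ¬ P x) → ∀ xs → count P? xs ≡ 0
  count-none P-none []       = refl
  count-none P-none (x ∷ xs) with P? x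
  ... | yes Px = contradiction Px (P-none x)
  ... | no _   = count-none P-none xs

  count-const : ∀ {c} {C : Set c} (C? : Dec C) → (∀ x → P x ⇔ C) →
                ∀ xs → count P? xs ≡ 𝟙 C? * length xs
  count-const C? P⇔C xs with C?
  ... | yes C = trans (count-all (λ x → Equivalence.from (P⇔C x) C) xs) (sym (+-identityʳ (length xs)))
  ... | no ¬C = count-none (λ x Px → ¬C (Equivalence.to (P⇔C x) Px)) xs

  sum-𝟙≡count : ∀ xs → sum (map (λ x → 𝟙 (P? x)) xs) ≡ count P? xs
  sum-𝟙≡count []       = refl
  sum-𝟙≡count (x ∷ xs) = trans (cong (𝟙 (P? x) +_) (sum-𝟙≡count xs)) (sym (count-∷ x xs))

  count-concatMap : ∀ {b} {B : Set b} (f : B → List A) ys →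
                    count P? (concatMap f ys) ≡ sum (map (λ y → count P? (f y)) ys)
  count-concatMap f []       = refl
  count-concatMap f (y ∷ ys) =
    trans (count-++ (f y) (concatMap f ys)) (cong (count P? (f y) +_) (count-concatMap f ys))

module _ {a p q} {A : Set a} {P : Pred A p} {Q : Pred A q} (P? : Decidable P) where

  count-cong : (Q? : Decidable Q) → (∀ x → P x ⇔ Q x) → ∀ xs → count P? xs ≡ count Q? xs
  count-cong Q? P⇔Q xs =
    cong length (filter-≐ P? Q? ((λ {x} → to (P⇔Q x)) , λ {x} → from (P⇔Q x)) xs)
    where open Equivalence

  count-filter : (Q? : Decidable Q) → ∀ xs →
                 count (λ x → Q? x ×-dec P? x) xs ≡ count P? (filter Q? xs)
  count-filter Q? []       = refl
  count-filter Q? (x ∷ xs) with does (Q? x)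
  ... | false = count-filter Q? xs
  ... | true with does (P? x)
  ...   | true  = cong suc (count-filter Q? xs)
  ...   | false = count-filter Q? xs

module _ {a b p} {A : Set a} {B : Set b} {P : Pred B p} (P? : Decidable P) where

  count-map : (f : A → B) → ∀ xs → count P? (map f xs) ≡ count (λ x → P? (f x)) xs
  count-map f []       = refl
  count-map f (x ∷ xs) with does (P? (f x))
  ... | true  = cong suc (count-map f xs)
  ... | false = count-map f xs

sum-map-linear : ∀ {a} {A : Set a} c (f g : A → ℕ) xs →
                 sum (map (λ x → c * f x + g x) xs) ≡ c * sum (map f xs) + sum (map g xs)
sum-map-linear c f g []       = sym (trans (+-identityʳ (c * 0)) (*-zeroʳ c))
sum-map-linear c f g (x ∷ xs) =
  trans (cong (c * f x + g x +_) (sum-map-linear c f g xs)) (regroup c (f x) (g x) _ _)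
  where
  regroup : ∀ c a b s t → c * a + b + (c * s + t) ≡ c * (a + s) + (b + t)
  regroup = solve-∀

count-allFin-suc : ∀ {n p} {P : Pred (Fin (suc n)) p} (P? : Decidable P) →
                   count P? (allFin (suc n)) ≡ 𝟙 (P? zero) + count (λ k → P? (suc k)) (allFin n)
count-allFin-suc {n} P? = begin
  count P? (allFin (suc n))                          ≡⟨ count-∷ P? zero (tabulate suc) ⟩
  𝟙 (P? zero) + count P? (tabulate suc)              ≡⟨ cong (λ ks → 𝟙 (P? zero) + count P? ks) (map-tabulate id suc) ⟨
  𝟙 (P? zero) + count P? (map suc (allFin n))        ≡⟨ cong (𝟙 (P? zero) +_) (count-map P? suc (allFin n)) ⟩
  𝟙 (P? zero) + count (λ k → P? (suc k)) (allFin n)  ∎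
  where open ≡-Reasoning

count-allFin-const : ∀ {n p c} {P : Pred (Fin n) p} {C : Set c} (P? : Decidable P) (C? : Dec C) →
                     (∀ k → P k ⇔ C) → count P? (allFin n) ≡ n * 𝟙 C?
count-allFin-const {n} P? C? P⇔C =
  trans (count-const P? C? P⇔C (allFin n)) (trans (cong (𝟙 C? *_) (length-tabulate id)) (*-comm (𝟙 C?) n))

count-≤toℕ : ∀ n a → count (λ (k : Fin n) → a ≤? toℕ k) (allFin n) ≡ n ∸ a
count-≤toℕ zero    a       = sym (0∸n≡0 a)
count-≤toℕ (suc n) zero    =
  trans (count-all (λ k → zero ≤? toℕ k) (λ _ → z≤n) (allFin (suc n))) (length-tabulate id)
count-≤toℕ (suc n) (suc a) = begin
  count (λ k → suc a ≤? toℕ k) (allFin (suc n))  ≡⟨ count-allFin-suc {n = n} (λ k → suc a ≤? toℕ k) ⟩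
  count (λ k → suc a ≤? suc (toℕ k)) (allFin n)  ≡⟨ count-cong (λ k → suc a ≤? suc (toℕ k)) (λ k → a ≤? toℕ k)
                                                                (λ _ → mk⇔ s≤s⁻¹ s≤s) (allFin n) ⟩
  count (λ k → a ≤? toℕ k) (allFin n)            ≡⟨ count-≤toℕ n a ⟩
  n ∸ a                                          ∎
  where open ≡-Reasoning

count-≡ : ∀ {n} (c : Fin n) → count (_≟ c) (allFin n) ≡ 1
count-≡ {suc n} zero    =
  trans (count-allFin-suc {n = n} (_≟ zero)) (cong suc (count-none (λ k → suc k ≟ zero) (λ _ ()) (allFin n)))
count-≡ {suc n} (suc c) = begin
  count (_≟ suc c) (allFin (suc n))       ≡⟨ count-allFin-suc {n = n} (_≟ suc c) ⟩
  count (λ k → suc k ≟ suc c) (allFin n)  ≡⟨ count-cong (λ k → suc k ≟ suc c) (_≟ c)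
                                                         (λ _ → mk⇔ suc-injective (cong suc)) (allFin n) ⟩
  count (_≟ c) (allFin n)                 ≡⟨ count-≡ c ⟩
  1                                       ∎
  where open ≡-Reasoning

%-wrap : ∀ {m x} .{{_ : NonZero m}} → m ≤ x → x ℕ.< m + m → x % m ≡ x ∸ m
%-wrap {m} {x} m≤x x<m+m = begin
  x % m            ≡⟨ cong (_% m) (m∸n+n≡m m≤x) ⟨
  (x ∸ m + m) % m  ≡⟨ [m+n]%n≡m%n (x ∸ m) m ⟩
  (x ∸ m) % m      ≡⟨ m<n⇒m%n≡m (m<n+o⇒m∸n<o x m x<m+m) ⟩
  x ∸ m            ∎
  where open ≡-Reasoning

+%<⇔ : ∀ {m k s} .{{_ : NonZero m}} → k ℕ.< m → s ℕ.< m → ((k + s) % m ℕ.< s ⇔ m ∸ s ≤ k)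
+%<⇔ {m} {k} {s} k<m s<m = mk⇔ (m≤k+s⇒m∸s≤k ∘′ wraps) (wrapped ∘′ m∸s≤k⇒m≤k+s)
  where
  m≤k+s⇒m∸s≤k : m ≤ k + s → m ∸ s ≤ k
  m≤k+s⇒m∸s≤k m≤k+s = m≤n+o⇒m∸n≤o m s (subst (m ≤_) (+-comm k s) m≤k+s)
  m∸s≤k⇒m≤k+s : m ∸ s ≤ k → m ≤ k + s
  m∸s≤k⇒m≤k+s m∸s≤k = subst (m ≤_) (+-comm s k) (≤-trans (m≤n+m∸n m s) (+-monoʳ-≤ s m∸s≤k))
  wraps : (k + s) % m ℕ.< s → m ≤ k + s
  wraps k+s%m<s = ≮⇒≥ λ k+s<m → <⇒≱ k+s%m<s (subst (s ≤_) (sym (m<n⇒m%n≡m k+s<m)) (m≤n+m s k))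
  wrapped : m ≤ k + s → (k + s) % m ℕ.< s
  wrapped m≤k+s = begin-strict
    (k + s) % m  ≡⟨ %-wrap m≤k+s (+-mono-< k<m s<m) ⟩
    k + s ∸ m    <⟨ ∸-monoˡ-< (+-monoˡ-< s k<m) m≤k+s ⟩
    m + s ∸ m    ≡⟨ m+n∸m≡n m s ⟩
    s            ∎
    where open ≤-Reasoning

+%≡0⇔ : ∀ {m k s} .{{_ : NonZero m}} → k ℕ.< m → s ℕ.< m → ((k + s) % m ≡ 0 ⇔ k ≡ (m ∸ s) % m)
+%≡0⇔ {m} {k} {zero} k<m _ = mk⇔
  (λ k+0%m≡0 → trans (trans (sym k+0%m≡k) k+0%m≡0) (sym (n%n≡0 m)))
  (λ k≡m%m → trans k+0%m≡k (trans k≡m%m (n%n≡0 m)))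
  where
  k+0%m≡k : (k + 0) % m ≡ k
  k+0%m≡k = trans (cong (_% m) (+-identityʳ k)) (m<n⇒m%n≡m k<m)
+%≡0⇔ {m@(suc m-1)} {k} {s@(suc s-1)} k<m s<m rewrite m<n⇒m%n≡m (s≤s (m∸n≤m m-1 s-1)) = mk⇔ to from
  where
  to : (k + s) % m ≡ 0 → k ≡ m ∸ s
  to k+s%m≡0 with k + s ℕ.<? m
  ... | yes k+s<m =
    contradiction (trans (sym (m<n⇒m%n≡m k+s<m)) k+s%m≡0) (m<n⇒n≢0 (<-≤-trans ℕ.z<s (m≤n+m s k)))
  ... | no  k+s≮m = begin
    k          ≡⟨ m+n∸n≡m k s ⟨
    k + s ∸ s  ≡⟨ cong (_∸ s) (≤-antisym (m∸n≡0⇒m≤n k+s∸m≡0) m≤k+s) ⟩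
    m ∸ s      ∎
    where
    open ≡-Reasoning
    m≤k+s : m ≤ k + s
    m≤k+s = ≮⇒≥ k+s≮m
    k+s∸m≡0 : k + s ∸ m ≡ 0
    k+s∸m≡0 = trans (sym (%-wrap m≤k+s (+-mono-< k<m s<m))) k+s%m≡0
  from : k ≡ m ∸ s → (k + s) % m ≡ 0
  from refl = trans (cong (_% m) (m∸n+n≡m (<⇒≤ s<m))) (n%n≡0 m)

module _ {m : ℕ} .{{_ : NonZero m}} where

  toℕ-⊕ : (a b : Fin m) → toℕ (a ⊕ b) ≡ (toℕ a + toℕ b) % m
  toℕ-⊕ a b = toℕ-fromℕ< (m%n<n (toℕ a + toℕ b) m)

  toℕ-𝟎⊕ : (a : Fin m) → toℕ (𝟎 m ⊕ a) ≡ toℕ a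
  toℕ-𝟎⊕ a = begin
    toℕ (𝟎 m ⊕ a)             ≡⟨ toℕ-⊕ (𝟎 m) a ⟩
    (toℕ (𝟎 m) + toℕ a) % m   ≡⟨ cong (λ z → (z + toℕ a) % m) (toℕ-fromℕ< (ℕ.>-nonZero⁻¹ m)) ⟩
    toℕ a % m                 ≡⟨ m<n⇒m%n≡m (toℕ<n a) ⟩
    toℕ a                     ∎
    where open ≡-Reasoning

  ⊖_ : Fin m → Fin m
  ⊖ a = fromℕ< (m%n<n (m ∸ toℕ a) m)

  ⊕-<⇔ : (k a : Fin m) → (k ⊕ a F.< a ⇔ m ∸ toℕ a ≤ toℕ k)
  ⊕-<⇔ k a =
    subst (λ t → (t ℕ.< toℕ a ⇔ m ∸ toℕ a ≤ toℕ k)) (sym (toℕ-⊕ k a)) (+%<⇔ (toℕ<n k) (toℕ<n a))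

  ⊕≡0⇔ : (k a : Fin m) → (toℕ (k ⊕ a) ≡ 0 ⇔ k ≡ ⊖ a)
  ⊕≡0⇔ k a = mk⇔
    (λ k⊕a≡0 → toℕ-injective (trans (to (trans (sym (toℕ-⊕ k a)) k⊕a≡0)) (sym (toℕ-fromℕ< _))))
    (λ k≡⊖a → trans (toℕ-⊕ k a) (from (trans (cong toℕ k≡⊖a) (toℕ-fromℕ< _))))
    where open Equivalence (+%≡0⇔ (toℕ<n k) (toℕ<n a))

module _ {m n : ℕ} {x y : Fin m} {b : Fin n} where

  Neg-col≡⇔ : Neg ((x , b) , (y , b)) ⇔ y F.< x
  Neg-col≡⇔ = mk⇔ to from
    where
    to : Neg ((x , b) , (y , b)) → y F.< x
    to (≢ , ¬pos) with F.<-cmp x y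
    ... | tri< x<y _ _ = contradiction (inj₁ (refl , x<y)) ¬pos
    ... | tri≈ _ x≡y _ = contradiction (cong (_, b) x≡y) ≢
    ... | tri> _ _ y<x = y<x
    from : y F.< x → Neg ((x , b) , (y , b))
    from y<x = (λ eq → F.<-irrefl (cong proj₁ (sym eq)) y<x)
             , λ { (inj₁ (_ , x<y))        → F.<-asym x<y y<x
                 ; (inj₂ (inj₁ (b<b , _))) → F.<-irrefl refl b<b
                 ; (inj₂ (inj₂ (b<b , _))) → F.<-irrefl refl b<b }

  Neg-col>⇔ : ∀ {c} → c F.< b → (Neg ((x , b) , (y , c)) ⇔ toℕ x ≢ 0)
  Neg-col>⇔ c<b = mk⇔
    (λ (_ , ¬pos) x≡0 → ¬pos (inj₂ (inj₁ (c<b , x≡0))))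
    (λ x≢0 → (λ eq → F.<-irrefl (cong proj₂ (sym eq)) c<b)
           , λ { (inj₁ (b≡c , _))       → F.<-irrefl (sym b≡c) c<b
               ; (inj₂ (inj₁ (_ , x≡0))) → x≢0 x≡0
               ; (inj₂ (inj₂ (b<c , _))) → F.<-asym b<c c<b })

  Neg-col<⇔ : ∀ {c} → b F.< c → (Neg ((x , b) , (y , c)) ⇔ toℕ y ≡ 0)
  Neg-col<⇔ b<c = mk⇔
    (λ (_ , ¬pos) → decidable-stable (toℕ y ℕ.≟ 0) (λ y≢0 → ¬pos (inj₂ (inj₂ (b<c , y≢0)))))
    (λ y≡0 → (λ eq → F.<-irrefl (cong proj₂ eq) b<c)
           , λ { (inj₁ (b≡c , _))        → F.<-irrefl b≡c b<c
               ; (inj₂ (inj₁ (c<b , _)))  → F.<-asym b<c c<b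
               ; (inj₂ (inj₂ (_ , y≢0))) → y≢0 y≡0 })

module _ {m n : ℕ} .{{_ : NonZero m}} (w : GElt m n) (p : Fin n) where

  private
    π : Fin n → Fin n
    π j = β w ⟨$⟩ʳ j

    negImage? : Decidable (λ ρ → Neg (actRoot w ρ))
    negImage? ρ = Neg? (actRoot w ρ)

  ascent? : (j : Fin n) → Dec (π j F.< π p × toℕ (r w p) ≢ 0)
  ascent? j = (π j <? π p) ×-dec ¬? (toℕ (r w p) ℕ.≟ 0)

  inversion? : (j : Fin n) → Dec (π p F.< π j)
  inversion? j = π p <? π j

  ascentCount inversionCount : ℕ
  ascentCount    = count (λ j → (j <? p) ×-dec ascent? j) (allFin n)
  inversionCount = count (λ j → (j <? p) ×-dec inversion? j) (allFin n)

  diagonal : List (Root m n)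
  diagonal = map (λ k → ((𝟎 m , p) , (k , p))) (filter (λ k → ¬? (toℕ k ℕ.≟ 0)) (allFin m))

  column : Fin n → List (Root m n)
  column j = map (λ k → ((𝟎 m , p) , (k , j))) (allFin m)

  offDiagonal : List (Root m n)
  offDiagonal = concatMap column (filter (_<? p) (allFin n))

  Neg-count-diagonal : count negImage? diagonal ≡ toℕ (r w p)
  Neg-count-diagonal = begin
    count negImage? (map diag (filter nonzero? (allFin m)))
      ≡⟨ count-map negImage? diag (filter nonzero? (allFin m)) ⟩
    count (λ k → negImage? (diag k)) (filter nonzero? (allFin m))
      ≡⟨ count-filter (λ k → negImage? (diag k)) nonzero? (allFin m) ⟨
    count (λ k → nonzero? k ×-dec negImage? (diag k)) (allFin m)
      ≡⟨ count-cong _ (λ k → m ∸ s ≤? toℕ k) wraps⇔ (allFin m) ⟩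
    count (λ k → m ∸ s ≤? toℕ k) (allFin m)
      ≡⟨ count-≤toℕ m (m ∸ s) ⟩
    m ∸ (m ∸ s)
      ≡⟨ m∸[m∸n]≡n (<⇒≤ (toℕ<n (r w p))) ⟩
    s ∎
    where
    open ≡-Reasoning
    s = toℕ (r w p)
    diag : Fin m → Root m n
    diag k = ((𝟎 m , p) , (k , p))
    nonzero? : (k : Fin m) → Dec (toℕ k ≢ 0)
    nonzero? k = ¬? (toℕ k ℕ.≟ 0)
    Neg⇔ : ∀ k → Neg (actRoot w (diag k)) ⇔ m ∸ s ≤ toℕ k
    Neg⇔ k = ⊕-<⇔ k (r w p)
         ⇔-∘ subst (λ t → Neg (actRoot w (diag k)) ⇔ toℕ (k ⊕ r w p) ℕ.< t) (toℕ-𝟎⊕ (r w p))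
                   Neg-col≡⇔
    wraps⇔ : ∀ k → (toℕ k ≢ 0 × Neg (actRoot w (diag k))) ⇔ m ∸ s ≤ toℕ k
    wraps⇔ k = mk⇔ (λ (_ , neg) → Equivalence.to (Neg⇔ k) neg)
      (λ m∸s≤k → (λ k≡0 → <⇒≱ (m<n⇒0<n∸m (toℕ<n (r w p))) (subst (m ∸ s ≤_) k≡0 m∸s≤k))
               , Equivalence.from (Neg⇔ k) m∸s≤k)

  Neg-count-column : ∀ j → j F.< p → count negImage? (column j) ≡ m * 𝟙 (ascent? j) + 𝟙 (inversion? j)
  Neg-count-column j j<p with F.<-cmp (π j) (π p)
  ... | tri≈ _ πj≡πp _ = contradiction (Injection.injective (↔⇒↣ (β w)) πj≡πp) (F.<⇒≢ j<p)
  ... | tri< πj<πp _ _ = begin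
    count negImage? (column j)                           ≡⟨ count-map negImage? _ (allFin m) ⟩
    count (λ k → negImage? (sink k)) (allFin m)          ≡⟨ count-allFin-const _ r≢0? Neg⇔ ⟩
    m * 𝟙 r≢0?                                           ≡⟨ +-identityʳ _ ⟨
    m * 𝟙 r≢0? + 0                                       ≡⟨ cong₂ (λ a i → m * a + i)
                                                              (𝟙-cong (ascent? j) r≢0? (mk⇔ proj₂ (πj<πp ,_)))
                                                              (𝟙-no (inversion? j) (F.<-asym πj<πp)) ⟨
    m * 𝟙 (ascent? j) + 𝟙 (inversion? j)                 ∎
    where
    open ≡-Reasoning
    sink : Fin m → Root m n
    sink k = ((𝟎 m , p) , (k , j))
    r≢0? : Dec (toℕ (r w p) ≢ 0)
    r≢0? = ¬? (toℕ (r w p) ℕ.≟ 0)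
    Neg⇔ : ∀ k → Neg (actRoot w (sink k)) ⇔ toℕ (r w p) ≢ 0
    Neg⇔ k = subst (λ t → Neg (actRoot w (sink k)) ⇔ t ≢ 0) (toℕ-𝟎⊕ (r w p)) (Neg-col>⇔ πj<πp)
  ... | tri> _ _ πp<πj = begin
    count negImage? (column j)                           ≡⟨ count-map negImage? _ (allFin m) ⟩
    count (λ k → negImage? (sink k)) (allFin m)          ≡⟨ count-cong _ (_≟ ⊖ r w j) Neg⇔ (allFin m) ⟩
    count (_≟ ⊖ r w j) (allFin m)                        ≡⟨ count-≡ (⊖ r w j) ⟩
    1                                                    ≡⟨ cong (_+ 1) (*-zeroʳ m) ⟨
    m * 0 + 1                                            ≡⟨ cong₂ (λ a i → m * a + i)
                                                              (𝟙-no (ascent? j) (λ (πj<πp , _) → F.<-asym πj<πp πp<πj))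
                                                              (𝟙-yes (inversion? j) πp<πj) ⟨
    m * 𝟙 (ascent? j) + 𝟙 (inversion? j)                 ∎
    where
    open ≡-Reasoning
    sink : Fin m → Root m n
    sink k = ((𝟎 m , p) , (k , j))
    Neg⇔ : ∀ k → Neg (actRoot w (sink k)) ⇔ k ≡ ⊖ r w j
    Neg⇔ k = ⊕≡0⇔ k (r w j) ⇔-∘ Neg-col<⇔ πp<πj

  Neg-count-offDiagonal : count negImage? offDiagonal ≡ m * ascentCount + inversionCount
  Neg-count-offDiagonal = begin
    count negImage? (concatMap column below)
      ≡⟨ count-concatMap negImage? column below ⟩
    sum (map (λ j → count negImage? (column j)) below)
      ≡⟨ cong sum (map-cong-local (All.map (λ {j} → Neg-count-column j) (all-filter (_<? p) (allFin n)))) ⟩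
    sum (map (λ j → m * 𝟙 (ascent? j) + 𝟙 (inversion? j)) below)
      ≡⟨ sum-map-linear m _ _ below ⟩
    m * sum (map (λ j → 𝟙 (ascent? j)) below) + sum (map (λ j → 𝟙 (inversion? j)) below)
      ≡⟨ cong₂ (λ a i → m * a + i) (sum-𝟙≡count ascent? below) (sum-𝟙≡count inversion? below) ⟩
    m * count ascent? below + count inversion? below
      ≡⟨ cong₂ (λ a i → m * a + i) (count-filter ascent? (_<? p) (allFin n))
                                   (count-filter inversion? (_<? p) (allFin n)) ⟨
    m * ascentCount + inversionCount
      ∎
    where
    open ≡-Reasoning
    below = filter (_<? p) (allFin n)

  Neg-count-Δcol : count Neg? (map (actRoot w) (Δcol m n p)) ≡ toℕ (r w p) + m * ascentCount + inversionCount
  Neg-count-Δcol = begin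
    count Neg? (map (actRoot w) (diagonal ++ offDiagonal))  ≡⟨ count-map Neg? (actRoot w) (diagonal ++ offDiagonal) ⟩
    count negImage? (diagonal ++ offDiagonal)               ≡⟨ count-++ negImage? diagonal offDiagonal ⟩
    count negImage? diagonal + count negImage? offDiagonal  ≡⟨ cong₂ _+_ Neg-count-diagonal Neg-count-offDiagonal ⟩
    toℕ (r w p) + (m * ascentCount + inversionCount)        ≡⟨ +-assoc (toℕ (r w p)) _ inversionCount ⟨
    toℕ (r w p) + m * ascentCount + inversionCount          ∎
    where open ≡-Reasoning

-- The formula holds for every m ≥ 1 and n.
theorem4p6 : (m n : ℕ) → 2 ≤ m → 1 ≤ n → {{_ : NonZero m}} →
    (w : GElt m n) → (i : Fin n) →
      (inv i w ≡ toℕ (r w (opposite i)) + m * ascCount i w + invPerm i (β w))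
      × (toℕ (r w (opposite i)) ≡ 0 → inv i w ≡ invPerm i (β w))
theorem4p6 m n _ _ w i = formula , λ r≡0 → begin
  inv i w
    ≡⟨ formula ⟩
  toℕ (r w (opposite i)) + m * ascCount i w + invPerm i (β w)
    ≡⟨ cong₂ (λ s a → s + m * a + invPerm i (β w)) r≡0 (no-ascents r≡0) ⟩
  m * 0 + invPerm i (β w)
    ≡⟨ cong (_+ invPerm i (β w)) (*-zeroʳ m) ⟩
  invPerm i (β w)
    ∎
  where
  open ≡-Reasoning
  formula : inv i w ≡ toℕ (r w (opposite i)) + m * ascCount i w + invPerm i (β w)
  formula = Neg-count-Δcol w (opposite i)
  no-ascents : toℕ (r w (opposite i)) ≡ 0 → ascCount i w ≡ 0
  no-ascents r≡0 = count-none _ (λ _ (_ , _ , r≢0) → r≢0 r≡0) (allFin n)
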